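{- Let $G=(V,E)$ be a graph and let $x=\{x_{uv}\}_{uv\in\binom V2}$ be a feasible solution of the charging LP of $G$. Then $\textsc{Cluster}(G,x)$ computes a correlation clustering of cost at most $3\sum_{uv}x_{uv}$. In particular, if $x$ is an $\alpha$-approximate solution of the charging LP (for some $\alpha\ge1$), then $\textsc{Cluster}(G,x)$ returns a $3\alpha$-approximate correlation clustering.
   Context: Correlation Clustering: given $G=(V,E)$, find a partition $C$ of $V$ minimizing $|E\triangle E_C|$, $E_C$ being the pairs inside common parts. A bad triplet of a graph is a set $uvw$ of three vertices inducing exactly two edges; $T(G)$ is the set of bad triplets of $G$. The charging LP of $G$: minimize $\sum_{uv\in\binom V2}x_{uv}$ subject to $x_{uv}+x_{vw}+x_{wu}\ge1$ for all $uvw\in T(G)$ and $x_{uv}\ge0$; an $\alpha$-approximate solution is a feasible solution with objective at most $\alpha$ times the LP optimum. $\textsc{Cluster}(G,x)$: while $V\ne\emptyset$, pick a pivot $u\in V$ minimizing $\left(\sum_{vw:\,uvw\in T(G)}1\right)/\left(\sum_{vw:\,uvw\in T(G)}x_{vw}\right)$ where $G$ is the current graph, add the cluster consisting of $u$ and its current neighbors, and remove these nodes and their incident edges from $G$. -}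

module Defs where

open import Data.Nat using (ℕ; _<ᵇ_)
open import Data.Fin using (Fin; toℕ; _≟_)
open import Data.Bool using (Bool; true; false; _∧_; _∨_; not; if_then_else_; _xor_)
open import Data.List using (List; []; _∷_; foldr; map; allFin)
open import Data.Bool.ListAction using (any)
open import Data.Rational using (ℚ; 0ℚ; 1ℚ; _+_; _*_; _≤_)
open import Data.Product using (_×_)
open import Relation.Binary.PropositionalEquality using (_≡_; _≢_)
open import Relation.Nullary.Decidable using (⌊_⌋)

record Graph (n : ℕ) : Set where
  field
    adj    : Fin n → Fin n → Bool
    sym    : ∀ u v → adj u v ≡ adj v u
    irrefl : ∀ u → adj u u ≡ false
open Graph public

VSet : ℕ → Set
VSet n = Fin n → Bool

fullSet : ∀ {n} → VSet n
fullSet _ = true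

sumℚ : ∀ {A : Set} → (A → ℚ) → List A → ℚ
sumℚ f = foldr (λ a acc → f a + acc) 0ℚ

-- Sum over all unordered pairs {u,v} of distinct vertices (taken as u < v).
ΣPairs : ∀ {n} → (Fin n → Fin n → ℚ) → ℚ
ΣPairs {n} f = sumℚ (λ u → sumℚ (λ v → if toℕ u <ᵇ toℕ v then f u v else 0ℚ) (allFin n)) (allFin n)

b2ℚ : Bool → ℚ
b2ℚ true  = 1ℚ
b2ℚ false = 0ℚ

b2ℕ : Bool → ℕ
b2ℕ true  = 1
b2ℕ false = 0

distinct3 : ∀ {n} → Fin n → Fin n → Fin n → Bool
distinct3 u v w = not ⌊ u ≟ v ⌋ ∧ not ⌊ v ≟ w ⌋ ∧ not ⌊ w ≟ u ⌋

isBad : ∀ {n} → Graph n → Fin n → Fin n → Fin n → Bool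
isBad G u v w with b2ℕ (adj G u v) Data.Nat.+ b2ℕ (adj G v w) Data.Nat.+ b2ℕ (adj G w u)
... | 2 = distinct3 u v w
... | _ = false

-- uvw is a bad triplet of the current graph G[R] (induced subgraph on R).
isBadIn : ∀ {n} → Graph n → VSet n → Fin n → Fin n → Fin n → Bool
isBadIn G R u v w = R u ∧ R v ∧ R w ∧ isBad G u v w

-- LP variables x_{uv}, uv ∈ (V choose 2): a symmetric function (diagonal unused).
LPVars : ℕ → Set
LPVars n = Fin n → Fin n → ℚ

SymmetricVars : ∀ {n} → LPVars n → Set
SymmetricVars x = ∀ u v → x u v ≡ x v u

Feasible : ∀ {n} → Graph n → LPVars n → Set
Feasible G x =
  (∀ u v → u ≢ v → 0ℚ ≤ x u v) ×
  (∀ u v w → isBad G u v w ≡ true → 1ℚ ≤ x u v + x v w + x w u)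

objective : ∀ {n} → LPVars n → ℚ
objective x = ΣPairs x

-- α-approximate (given feasibility of x): objective at most α times the
-- objective of every (symmetric) feasible solution, i.e. α times the LP optimum.
ApproxLP : ∀ {n} → Graph n → ℚ → LPVars n → Set
ApproxLP {n} G α x =
  Feasible G x ×
  (∀ (y : LPVars n) → SymmetricVars y → Feasible G y → objective x ≤ α * objective y)

badCount : ∀ {n} → Graph n → VSet n → Fin n → ℚ
badCount G R u = ΣPairs (λ v w → b2ℚ (isBadIn G R u v w))

badMass : ∀ {n} → Graph n → LPVars n → VSet n → Fin n → ℚ
badMass G x R u = ΣPairs (λ v w → if isBadIn G R u v w then x v w else 0ℚ)

-- u ∈ R minimizes badCount/badMass over R (ratios compared by cross-multiplication;
-- denominators are nonnegative).
ValidPivot : ∀ {n} → Graph n → LPVars n → VSet n → Fin n → Set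
ValidPivot G x R u =
  R u ≡ true ×
  (∀ v → R v ≡ true → badCount G R u * badMass G x R v ≤ badCount G R v * badMass G x R u)

clusterOf : ∀ {n} → Graph n → VSet n → Fin n → VSet n
clusterOf G R u v = R v ∧ (⌊ v ≟ u ⌋ ∨ adj G u v)

removeSet : ∀ {n} → VSet n → VSet n → VSet n
removeSet R K v = R v ∧ not (K v)

-- Run G x R C : one possible execution of Cluster(G[R], x) outputs the clusters C.
data Run {n} (G : Graph n) (x : LPVars n) : VSet n → List (VSet n) → Set where
  done : ∀ {R} → (∀ v → R v ≡ false) → Run G x R []
  step : ∀ {R C} (u : Fin n) → ValidPivot G x R u →
         Run G x (removeSet R (clusterOf G R u)) C →
         Run G x R (clusterOf G R u ∷ C)

costRel : ∀ {n} → Graph n → (Fin n → Fin n → Bool) → ℚ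
costRel G same = ΣPairs (λ u v → b2ℚ (adj G u v xor same u v))

sameIn : ∀ {n} → List (VSet n) → Fin n → Fin n → Bool
sameIn C u v = any (λ K → K u ∧ K v) C

cost : ∀ {n} → Graph n → List (VSet n) → ℚ
cost G C = costRel G (sameIn C)

-- Any partition of V is given by a labelling p : V → Fin n.
costLabel : ∀ {n} → Graph n → (Fin n → Fin n) → ℚ
costLabel G p = costRel G (λ u v → ⌊ p u ≟ p v ⌋)

three : ℚ
three = 1ℚ + 1ℚ + 1ℚ

-- When a pivot u with cluster K is chosen, every pair the step decides wrongly (inside K, or
-- between K and the rest) forms a bad triplet with u, while the LP mass x_vw of the bad triplets
-- uvw lies on pairs with an endpoint in K, which leave the instance with K. So each step is paid
-- for once the number of bad triplets through u is at most three times their mass. Summed over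
-- all vertices this holds, since each bad triplet is counted at its three vertices and carries
-- mass at least 1 by feasibility; a pivot of minimal ratio count/mass therefore satisfies it.
-- For the 3α bound, the pairs on which a partition disagrees with G form a feasible LP solution:
-- equality of labels is transitive, so it cannot induce exactly two edges on a triangle.

module Submission where

open import Defs hiding (sym)
open import Data.Nat using (ℕ)
open import Data.Fin using (Fin)
open import Data.List using (List)
open import Data.Rational using (ℚ; 1ℚ; _*_; _≤_)
open import Data.Product using (_×_; ∃)

open import Algebra.Bundles using (CommutativeMonoid; CommutativeRing)
import Algebra.Solver.CommutativeMonoid
open import Data.Bool using (Bool; true; false; not; T; _∧_; _∨_; _xor_; if_then_else_)
import Data.Bool as Bool
open import Data.Bool.Properties using (∧-conicalˡ; ∧-conicalʳ; ∧-zeroʳ; ∨-zeroʳ; ¬-not; ∧-commutativeMonoid)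
open import Data.Empty using (⊥; ⊥-elim)
open import Data.Fin using (zero; suc; toℕ; _≟_)
open import Data.Fin.Properties using (toℕ-injective; any?)
open import Data.List using ([]; _∷_; tabulate; allFin)
open import Data.List.Membership.Propositional.Properties using (∈-allFin)
open import Data.List.Relation.Unary.All as All using (All; []; _∷_)
open import Data.Nat using (_<ᵇ_; _≡ᵇ_)
import Data.Nat as ℕ
import Data.Nat.Properties as ℕ
open import Data.Nat.Induction using (<-wellFounded)
open import Data.Product using (_,_; proj₁; proj₂; uncurry; map)
open import Data.Rational using (0ℚ; _+_; _<_; positive; nonNegative)
open import Data.Rational.Properties
  using ( ≤-refl; ≤-trans; ≤-reflexive; ≤-total; ≤-antisym; _≤?_; _<?_; ≮⇒≥; ≰⇒>; <-irrefl; <-≤-trans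
        ; +-mono-≤; +-mono-<; +-monoʳ-≤; +-identityˡ; +-identityʳ; +-assoc; +-comm
        ; *-zeroʳ; *-distribˡ-+; *-assoc; *-monoˡ-≤-nonNeg; *-monoʳ-≤-nonNeg; *-cancelʳ-≤-pos
        ; +-*-commutativeRing; *-1-commutativeMonoid; module ≤-Reasoning )
open import Data.Rational.Solver using (module +-*-Solver)
open import Data.Sum using (_⊎_; inj₁; inj₂)
open import Data.Vec.Functional using (Vector)
open import Function using (_∘_; id)
open import Induction.WellFounded using (Acc; acc)
open import Relation.Binary.PropositionalEquality
  using (_≡_; _≢_; refl; sym; trans; cong; cong₂; subst; subst₂; module ≡-Reasoning)
open import Relation.Nullary using (¬_; Dec; yes; no; contradiction)
open import Relation.Nullary.Decidable using (_×-dec_; ⌊_⌋; isYes≗does; dec-true; dec-false; from-yes)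
open import Relation.Nullary.Reflects using (ofʸ; ofⁿ)
open import Level using (0ℓ)
open import Relation.Unary using (Pred; Decidable)

open import Algebra.Properties.CommutativeSemigroup
  (CommutativeMonoid.commutativeSemigroup *-1-commutativeMonoid) using (xy∙z≈xz∙y)
open import Algebra.Properties.Semiring.Sum (CommutativeRing.semiring +-*-commutativeRing)
  using (sum; sum-syntax; sum-cong-≗; sum-replicate-zero; ∑-comm; ∑-distrib-+; *-distribˡ-sum; *-distribʳ-sum)

p≤p+q : ∀ {p q} → 0ℚ ≤ q → p ≤ p + q
p≤p+q {p} 0≤q = ≤-trans (≤-reflexive (sym (+-identityʳ p))) (+-monoʳ-≤ p 0≤q)

p≤q+p : ∀ {p q} → 0ℚ ≤ q → p ≤ q + p
p≤q+p {p} {q} 0≤q = subst (p ≤_) (+-comm p q) (p≤p+q 0≤q)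

+-nonneg : ∀ {p q} → 0ℚ ≤ p → 0ℚ ≤ q → 0ℚ ≤ p + q
+-nonneg {p} {q} 0≤p 0≤q = subst (_≤ p + q) (+-identityˡ 0ℚ) (+-mono-≤ 0≤p 0≤q)

*-nonneg : ∀ {p q} → 0ℚ ≤ p → 0ℚ ≤ q → 0ℚ ≤ p * q
*-nonneg {p} {q} 0≤p 0≤q = subst (_≤ p * q) (*-zeroʳ p) (*-monoˡ-≤-nonNeg p {{nonNegative 0≤p}} 0≤q)

0≤three : 0ℚ ≤ three
0≤three = from-yes (0ℚ ≤? three)

halve-≤ : ∀ {p q} → p + p ≤ q + q → p ≤ q
halve-≤ {p} {q} p+p≤q+q with p ≤? q
... | yes p≤q = p≤q
... | no p≰q = contradiction (<-≤-trans (+-mono-< q<p q<p) p+p≤q+q) (<-irrefl refl)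
  where q<p = ≰⇒> p≰q

sum-mono : ∀ {n} {f g : Vector ℚ n} → (∀ i → f i ≤ g i) → sum f ≤ sum g
sum-mono {ℕ.zero}  _   = ≤-refl
sum-mono {ℕ.suc n} f≤g = +-mono-≤ (f≤g zero) (sum-mono (f≤g ∘ suc))

sum-zero : ∀ {n} {f : Vector ℚ n} → (∀ i → f i ≡ 0ℚ) → sum f ≡ 0ℚ
sum-zero {n} f≡0 = trans (sum-cong-≗ f≡0) (sum-replicate-zero n)

sum-nonneg : ∀ {n} {f : Vector ℚ n} → (∀ i → 0ℚ ≤ f i) → 0ℚ ≤ sum f
sum-nonneg {n} {f} 0≤f = subst (_≤ sum f) (sum-replicate-zero n) (sum-mono 0≤f)

term≤sum : ∀ {n} {f : Vector ℚ n} → (∀ i → 0ℚ ≤ f i) → ∀ i → f i ≤ sum f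
term≤sum 0≤f zero    = p≤p+q (sum-nonneg (0≤f ∘ suc))
term≤sum 0≤f (suc i) = ≤-trans (term≤sum (0≤f ∘ suc) i) (p≤q+p (0≤f zero))

∑² : ∀ {n} → (Fin n → Fin n → ℚ) → ℚ
∑² {n} f = ∑[ u < n ] ∑[ v < n ] f u v

∑²-+ : ∀ {n} (f g : Fin n → Fin n → ℚ) → ∑² (λ u v → f u v + g u v) ≡ ∑² f + ∑² g
∑²-+ f g = trans (sum-cong-≗ λ u → ∑-distrib-+ (f u) (g u)) (∑-distrib-+ (λ u → sum (f u)) (λ u → sum (g u)))

∑²-transpose : ∀ {n} (f : Fin n → Fin n → ℚ) → ∑² (λ u v → f v u) ≡ ∑² f
∑²-transpose f = ∑-comm (λ u v → f v u)

∑³ : ∀ {n} → (Fin n → Fin n → Fin n → ℚ) → ℚ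
∑³ {n} f = ∑[ u < n ] ∑² (f u)

∑³-mono : ∀ {n} {f g : Fin n → Fin n → Fin n → ℚ} → (∀ u v w → f u v w ≤ g u v w) → ∑³ f ≤ ∑³ g
∑³-mono f≤g = sum-mono λ u → sum-mono λ v → sum-mono λ w → f≤g u v w

∑³-+ : ∀ {n} (f g : Fin n → Fin n → Fin n → ℚ) → ∑³ (λ u v w → f u v w + g u v w) ≡ ∑³ f + ∑³ g
∑³-+ f g = trans (sum-cong-≗ λ u → ∑²-+ (f u) (g u)) (∑-distrib-+ (λ u → ∑² (f u)) (λ u → ∑² (g u)))

∑³-rotate : ∀ {n} (f : Fin n → Fin n → Fin n → ℚ) → ∑³ (λ u v w → f v w u) ≡ ∑³ f
∑³-rotate {n} f = trans (∑-comm λ u v → ∑[ w < n ] f v w u) (sum-cong-≗ λ v → ∑²-transpose (f v))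

-- Minimal ratios

module Ratio {n : ℕ} (c m : Vector ℚ n) (c≥0 : ∀ v → 0ℚ ≤ c v) (m≥0 : ∀ v → 0ℚ ≤ m v) where

  -- c u / m u ≤ c v / m v, cross-multiplied so that m may vanish.
  _≼_ : Fin n → Fin n → Set
  u ≼ v = c u * m v ≤ c v * m u

  ≼-trans : ∀ {u v w} → 0ℚ < m v → u ≼ v → v ≼ w → u ≼ w
  ≼-trans {u} {v} {w} 0<mv u≼v v≼w = *-cancelʳ-≤-pos (m v) {{positive 0<mv}} (begin
    c u * m w * m v  ≡⟨ xy∙z≈xz∙y (c u) (m w) (m v) ⟩
    c u * m v * m w  ≤⟨ *-monoʳ-≤-nonNeg (m w) {{nonNegative (m≥0 w)}} u≼v ⟩
    c v * m u * m w  ≡⟨ xy∙z≈xz∙y (c v) (m u) (m w) ⟩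
    c v * m w * m u  ≤⟨ *-monoʳ-≤-nonNeg (m u) {{nonNegative (m≥0 u)}} v≼w ⟩
    c w * m v * m u  ≡⟨ xy∙z≈xz∙y (c w) (m v) (m u) ⟩
    c w * m u * m v  ∎)
    where open ≤-Reasoning

  ≼-massless : ∀ {u v} → m v ≡ 0ℚ → u ≼ v
  ≼-massless {u} {v} mv≡0 = begin
    c u * m v  ≡⟨ cong (c u *_) mv≡0 ⟩
    c u * 0ℚ   ≡⟨ *-zeroʳ (c u) ⟩
    0ℚ         ≤⟨ *-nonneg (c≥0 v) (m≥0 u) ⟩
    c v * m u  ∎
    where open ≤-Reasoning

  module _ {P : Pred (Fin n) 0ℓ} (P? : Decidable P) where

    Massive : Pred (Fin n) 0ℓ
    Massive v = P v × 0ℚ < m v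

    least-massive : ∀ (vs : List (Fin n)) →
      All (¬_ ∘ Massive) vs ⊎ ∃ λ u → Massive u × All (λ v → Massive v → u ≼ v) vs
    least-massive [] = inj₁ []
    least-massive (v ∷ vs) with P? v ×-dec 0ℚ <? m v | least-massive vs
    ... | no ¬mv | inj₁ none             = inj₁ (¬mv ∷ none)
    ... | no ¬mv | inj₂ (u , mu , least) = inj₂ (u , mu , (λ mv → contradiction mv ¬mv) ∷ least)
    ... | yes mv | inj₁ none             =
      inj₂ (v , mv , (λ _ → ≤-refl) ∷ All.map (λ ¬mw mw → contradiction mw ¬mw) none)
    ... | yes mv | inj₂ (u , mu , least) with ≤-total (c v * m u) (c u * m v)
    ...   | inj₁ v≼u =
      inj₂ (v , mv , (λ _ → ≤-refl) ∷ All.map (λ u≼ mw → ≼-trans (proj₂ mu) v≼u (u≼ mw)) least)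
    ...   | inj₂ u≼v = inj₂ (u , mu , (λ _ → u≼v) ∷ least)

    ≼-all : ∀ {u} → (∀ v → Massive v → u ≼ v) → ∀ v → P v → u ≼ v
    ≼-all u≼massive v Pv with 0ℚ <? m v
    ... | yes 0<mv = u≼massive v (Pv , 0<mv)
    ... | no  0≮mv = ≼-massless (≤-antisym (≮⇒≥ 0≮mv) (m≥0 v))

    ratio-minimiser : ∃ P → ∃ λ u → P u × ∀ v → P v → u ≼ v
    ratio-minimiser (v₀ , Pv₀) with least-massive (allFin n)
    ... | inj₁ none = v₀ , Pv₀ , ≼-all (λ v mv → contradiction mv (All.lookup none (∈-allFin v)))
    ... | inj₂ (u , (Pu , _) , least) = u , Pu , ≼-all (λ v → All.lookup least (∈-allFin v))

  ratio-bound : ∀ {k u} → 0ℚ ≤ k → sum c ≤ k * sum m → (∀ v → u ≼ v) → c u ≤ k * m u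
  ratio-bound {k} {u} 0≤k Σc≤kΣm u-least with 0ℚ <? sum m
  ... | yes 0<Σm = *-cancelʳ-≤-pos (sum m) {{positive 0<Σm}} (begin
    c u * sum m            ≡⟨ *-distribˡ-sum (c u) m ⟩
    sum (λ v → c u * m v)  ≤⟨ sum-mono u-least ⟩
    sum (λ v → c v * m u)  ≡⟨ *-distribʳ-sum (m u) c ⟨
    sum c * m u            ≤⟨ *-monoʳ-≤-nonNeg (m u) {{nonNegative (m≥0 u)}} Σc≤kΣm ⟩
    k * sum m * m u        ≡⟨ xy∙z≈xz∙y k (sum m) (m u) ⟩
    k * m u * sum m        ∎)
    where open ≤-Reasoning
  ... | no 0≮Σm = begin
    c u        ≤⟨ term≤sum c≥0 u ⟩
    sum c      ≤⟨ Σc≤kΣm ⟩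
    k * sum m  ≤⟨ *-monoˡ-≤-nonNeg k {{nonNegative 0≤k}} (≮⇒≥ 0≮Σm) ⟩
    k * 0ℚ     ≡⟨ *-zeroʳ k ⟩
    0ℚ         ≤⟨ *-nonneg 0≤k (m≥0 u) ⟩
    k * m u    ∎
    where open ≤-Reasoning

[_]·_ : Bool → ℚ → ℚ
[ b ]· q = if b then q else 0ℚ

[]·-mono : ∀ b {p q} → (T b → p ≤ q) → [ b ]· p ≤ [ b ]· q
[]·-mono true  p≤q = p≤q _
[]·-mono false _   = ≤-refl

[]·-zero : ∀ b → [ b ]· 0ℚ ≡ 0ℚ
[]·-zero true  = refl
[]·-zero false = refl

[]·-+ : ∀ b p q → [ b ]· (p + q) ≡ [ b ]· p + [ b ]· q
[]·-+ true  p q = refl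
[]·-+ false p q = sym (+-identityˡ 0ℚ)

upper : ∀ {n} → (Fin n → Fin n → ℚ) → Fin n → Fin n → ℚ
upper f u v = [ toℕ u <ᵇ toℕ v ]· f u v

sumℚ-tabulate : ∀ {A : Set} {n} (f : A → ℚ) (g : Fin n → A) → sumℚ f (tabulate g) ≡ sum (f ∘ g)
sumℚ-tabulate {n = ℕ.zero}  f g = refl
sumℚ-tabulate {n = ℕ.suc n} f g = cong (f (g zero) +_) (sumℚ-tabulate f (g ∘ suc))

ΣPairs-∑² : ∀ {n} (f : Fin n → Fin n → ℚ) → ΣPairs f ≡ ∑² (upper f)
ΣPairs-∑² {n} f = trans (sumℚ-tabulate (λ u → sumℚ (upper f u) (allFin n)) id)
                        (sum-cong-≗ λ u → sumℚ-tabulate (upper f u) id)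

toℕ<⇒≢ : ∀ {n} {v w : Fin n} → toℕ v ℕ.< toℕ w → v ≢ w
toℕ<⇒≢ v<w v≡w = ℕ.<-irrefl (cong toℕ v≡w) v<w

module _ {n : ℕ} where

  ΣPairs-mono : ∀ {f g : Fin n → Fin n → ℚ} → (∀ u v → toℕ u ℕ.< toℕ v → f u v ≤ g u v) → ΣPairs f ≤ ΣPairs g
  ΣPairs-mono {f} {g} f≤g = subst₂ _≤_ (sym (ΣPairs-∑² f)) (sym (ΣPairs-∑² g))
    (sum-mono λ u → sum-mono λ v → []·-mono (toℕ u <ᵇ toℕ v) (f≤g u v ∘ ℕ.<ᵇ⇒< (toℕ u) (toℕ v)))

  ΣPairs-zero : ∀ {f : Fin n → Fin n → ℚ} → (∀ u v → f u v ≡ 0ℚ) → ΣPairs f ≡ 0ℚ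
  ΣPairs-zero {f} f≡0 = trans (ΣPairs-∑² f)
    (sum-zero λ u → sum-zero λ v → trans (cong [ toℕ u <ᵇ toℕ v ]·_ (f≡0 u v)) ([]·-zero _))

  ΣPairs-nonneg : ∀ {f : Fin n → Fin n → ℚ} → (∀ u v → toℕ u ℕ.< toℕ v → 0ℚ ≤ f u v) → 0ℚ ≤ ΣPairs f
  ΣPairs-nonneg {f} 0≤f = subst (_≤ ΣPairs f) (ΣPairs-zero {λ _ _ → 0ℚ} λ _ _ → refl) (ΣPairs-mono 0≤f)

  ΣPairs-+ : ∀ (f g : Fin n → Fin n → ℚ) → ΣPairs (λ u v → f u v + g u v) ≡ ΣPairs f + ΣPairs g
  ΣPairs-+ f g = begin
    ΣPairs (λ u v → f u v + g u v)          ≡⟨ ΣPairs-∑² (λ u v → f u v + g u v) ⟩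
    ∑² (upper (λ u v → f u v + g u v))      ≡⟨ sum-cong-≗ (λ u → sum-cong-≗ λ v → []·-+ _ (f u v) (g u v)) ⟩
    ∑² (λ u v → upper f u v + upper g u v)  ≡⟨ ∑²-+ (upper f) (upper g) ⟩
    ∑² (upper f) + ∑² (upper g)             ≡⟨ sym (cong₂ _+_ (ΣPairs-∑² f) (ΣPairs-∑² g)) ⟩
    ΣPairs f + ΣPairs g                     ∎
    where open ≡-Reasoning

  ∑²-symmetric : ∀ (f : Fin n → Fin n → ℚ) → (∀ u v → f u v ≡ f v u) → (∀ u → f u u ≡ 0ℚ) →
                 ∑² f ≡ ΣPairs f + ΣPairs f
  ∑²-symmetric f f-sym f-diag = begin
    ∑² f                                          ≡⟨ sum-cong-≗ (λ u → sum-cong-≗ (split u)) ⟩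
    ∑² (λ u v → upper f u v + upper f v u)        ≡⟨ ∑²-+ (upper f) (λ u v → upper f v u) ⟩
    ∑² (upper f) + ∑² (λ u v → upper f v u)       ≡⟨ cong (∑² (upper f) +_) (∑²-transpose (upper f)) ⟩
    ∑² (upper f) + ∑² (upper f)                   ≡⟨ sym (cong₂ _+_ (ΣPairs-∑² f) (ΣPairs-∑² f)) ⟩
    ΣPairs f + ΣPairs f                           ∎
    where
    open ≡-Reasoning
    split : ∀ u v → f u v ≡ upper f u v + upper f v u
    split u v with toℕ u <ᵇ toℕ v | ℕ.<ᵇ-reflects-< (toℕ u) (toℕ v)
                 | toℕ v <ᵇ toℕ u | ℕ.<ᵇ-reflects-< (toℕ v) (toℕ u)
    ... | true  | ofʸ u<v | true  | ofʸ v<u = contradiction v<u (ℕ.<-asym u<v)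
    ... | true  | _       | false | _       = sym (+-identityʳ (f u v))
    ... | false | _       | true  | _       = trans (f-sym u v) (sym (+-identityˡ (f v u)))
    ... | false | ofⁿ u≮v | false | ofⁿ v≮u = begin
      f u v   ≡⟨ cong (f u) (toℕ-injective (ℕ.≤-antisym (ℕ.≮⇒≥ v≮u) (ℕ.≮⇒≥ u≮v))) ⟨
      f u u   ≡⟨ f-diag u ⟩
      0ℚ      ≡⟨ +-identityˡ 0ℚ ⟨
      0ℚ + 0ℚ ∎

∧-true⁺ : ∀ {a b} → a ≡ true → b ≡ true → a ∧ b ≡ true
∧-true⁺ refl refl = refl

∧-true⁻ : ∀ {a b} → a ∧ b ≡ true → a ≡ true × b ≡ true
∧-true⁻ {true} b≡true = refl , b≡true

∨-true⁻ : ∀ {a b} → a ∨ b ≡ true → a ≡ true ⊎ b ≡ true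
∨-true⁻ {true}  _      = inj₁ refl
∨-true⁻ {false} b≡true = inj₂ b≡true

xor-false⇒≡ : ∀ a b → a xor b ≡ false → a ≡ b
xor-false⇒≡ false false _ = refl
xor-false⇒≡ true  true  _ = refl
xor-false⇒≡ false true  ()
xor-false⇒≡ true  false ()

⌊⌋-true : ∀ {A : Set} (a? : Dec A) → A → ⌊ a? ⌋ ≡ true
⌊⌋-true a? a = trans (isYes≗does a?) (dec-true a? a)

⌊⌋-false : ∀ {A : Set} (a? : Dec A) → ¬ A → ⌊ a? ⌋ ≡ false
⌊⌋-false a? ¬a = trans (isYes≗does a?) (dec-false a? ¬a)

⌊≟⌋-sym : ∀ {n} (u v : Fin n) → ⌊ u ≟ v ⌋ ≡ ⌊ v ≟ u ⌋
⌊≟⌋-sym u v with u ≟ v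
... | yes u≡v = sym (⌊⌋-true (v ≟ u) (sym u≡v))
... | no  u≢v = sym (⌊⌋-false (v ≟ u) (u≢v ∘ sym))

b2ℚ-nonneg : ∀ b → 0ℚ ≤ b2ℚ b
b2ℚ-nonneg true  = from-yes (0ℚ ≤? 1ℚ)
b2ℚ-nonneg false = ≤-refl

b2ℚ-cover : ∀ {a b c} → (a ≡ true → b ≡ true ⊎ c ≡ true) → b2ℚ a ≤ b2ℚ b + b2ℚ c
b2ℚ-cover {false} {b} {c} _ = +-nonneg (b2ℚ-nonneg b) (b2ℚ-nonneg c)
b2ℚ-cover {true}  {b} {c} cover with cover refl
... | inj₁ refl = p≤p+q (b2ℚ-nonneg c)
... | inj₂ refl = p≤q+p (b2ℚ-nonneg b)

1≤b2ℚ-sum : ∀ {a b c} → a ≡ true ⊎ b ≡ true ⊎ c ≡ true → 1ℚ ≤ b2ℚ a + b2ℚ b + b2ℚ c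
1≤b2ℚ-sum {a} {b} {c} (inj₁ refl)        = ≤-trans (p≤p+q (b2ℚ-nonneg b)) (p≤p+q (b2ℚ-nonneg c))
1≤b2ℚ-sum {a} {b} {c} (inj₂ (inj₁ refl)) = ≤-trans (p≤q+p (b2ℚ-nonneg a)) (p≤p+q (b2ℚ-nonneg c))
1≤b2ℚ-sum {a} {b} {c} (inj₂ (inj₂ refl)) = p≤q+p (+-nonneg (b2ℚ-nonneg a) (b2ℚ-nonneg b))

[]·-nonneg : ∀ b {q} → 0ℚ ≤ q → 0ℚ ≤ [ b ]· q
[]·-nonneg true  0≤q = 0≤q
[]·-nonneg false _   = ≤-refl

[]·-disjoint : ∀ {P Q S q} → 0ℚ ≤ q → (Q ≡ true → P ≡ true) → (S ≡ true → P ≡ true) →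
               (Q ≡ true → S ≡ true → ⊥) → [ Q ]· q + [ S ]· q ≤ [ P ]· q
[]·-disjoint {P} {true}  {true}  _   _   _   disjoint = ⊥-elim (disjoint refl refl)
[]·-disjoint {P} {true}  {false} _   Q⇒P _   _ rewrite Q⇒P refl = ≤-reflexive (+-identityʳ _)
[]·-disjoint {P} {false} {true}  _   _   S⇒P _ rewrite S⇒P refl = ≤-reflexive (+-identityˡ _)
[]·-disjoint {P} {false} {false} 0≤q _   _   _ = ≤-trans (≤-reflexive (+-identityˡ 0ℚ)) ([]·-nonneg P 0≤q)

-- Bad triplets

exactlyTwo : Bool → Bool → Bool → Bool
exactlyTwo p q r = b2ℕ p ℕ.+ b2ℕ q ℕ.+ b2ℕ r ≡ᵇ 2

exactlyTwo-rotate : ∀ p q r → exactlyTwo p q r ≡ exactlyTwo q r p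
exactlyTwo-rotate p q r = cong (_≡ᵇ 2) (trans (ℕ.+-assoc (b2ℕ p) (b2ℕ q) (b2ℕ r)) (ℕ.+-comm (b2ℕ p) _))

exactlyTwo-reverse : ∀ p q r → exactlyTwo p q r ≡ exactlyTwo r q p
exactlyTwo-reverse p q r = cong (_≡ᵇ 2) (begin
  b2ℕ p ℕ.+ b2ℕ q ℕ.+ b2ℕ r    ≡⟨ ℕ.+-comm (b2ℕ p ℕ.+ b2ℕ q) (b2ℕ r) ⟩
  b2ℕ r ℕ.+ (b2ℕ p ℕ.+ b2ℕ q)  ≡⟨ cong (b2ℕ r ℕ.+_) (ℕ.+-comm (b2ℕ p) (b2ℕ q)) ⟩
  b2ℕ r ℕ.+ (b2ℕ q ℕ.+ b2ℕ p)  ≡⟨ ℕ.+-assoc (b2ℕ r) (b2ℕ q) (b2ℕ p) ⟨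
  b2ℕ r ℕ.+ b2ℕ q ℕ.+ b2ℕ p    ∎)
  where open ≡-Reasoning

exactlyTwo-∨ : ∀ p q r → exactlyTwo p q r ≡ true → p ≡ true ⊎ r ≡ true
exactlyTwo-∨ true  _     _     _ = inj₁ refl
exactlyTwo-∨ false _     true  _ = inj₂ refl
exactlyTwo-∨ false true  false ()
exactlyTwo-∨ false false false ()

exactlyTwo-true-p-p : ∀ p → exactlyTwo true p p ≡ false
exactlyTwo-true-p-p true  = refl
exactlyTwo-true-p-p false = refl

exactlyTwo-p-p-true : ∀ p → exactlyTwo p p true ≡ false
exactlyTwo-p-p-true true  = refl
exactlyTwo-p-p-true false = refl

module ∧-Solver = Algebra.Solver.CommutativeMonoid ∧-commutativeMonoid

∧-rotate : ∀ a b c → a ∧ b ∧ c ≡ b ∧ c ∧ a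
∧-rotate = solve 3 (λ a b c → a ⊕ (b ⊕ c) ⊜ b ⊕ (c ⊕ a)) refl
  where open ∧-Solver

∧-reverse : ∀ a b c → a ∧ b ∧ c ≡ c ∧ b ∧ a
∧-reverse = solve 3 (λ a b c → a ⊕ (b ⊕ c) ⊜ c ⊕ (b ⊕ a)) refl
  where open ∧-Solver

module _ {n : ℕ} (G : Graph n) where

  isBad-exactlyTwo : ∀ u v w → isBad G u v w ≡ exactlyTwo (adj G u v) (adj G v w) (adj G w u) ∧ distinct3 u v w
  isBad-exactlyTwo u v w with b2ℕ (adj G u v) ℕ.+ b2ℕ (adj G v w) ℕ.+ b2ℕ (adj G w u)
  ... | 0 = refl
  ... | 1 = refl
  ... | 2 = refl
  ... | ℕ.suc (ℕ.suc (ℕ.suc _)) = refl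

  isBad-rotate : ∀ u v w → isBad G u v w ≡ isBad G v w u
  isBad-rotate u v w rewrite isBad-exactlyTwo u v w | isBad-exactlyTwo v w u =
    cong₂ _∧_ (exactlyTwo-rotate (adj G u v) (adj G v w) (adj G w u))
              (∧-rotate (not ⌊ u ≟ v ⌋) (not ⌊ v ≟ w ⌋) (not ⌊ w ≟ u ⌋))

  isBad-swap : ∀ u v w → isBad G u v w ≡ isBad G u w v
  isBad-swap u v w rewrite isBad-exactlyTwo u v w | isBad-exactlyTwo u w v
    | Graph.sym G u w | Graph.sym G w v | Graph.sym G v u | ⌊≟⌋-sym u w | ⌊≟⌋-sym w v | ⌊≟⌋-sym v u =
    cong₂ _∧_ (exactlyTwo-reverse (adj G u v) (adj G v w) (adj G w u))
              (∧-reverse (not ⌊ u ≟ v ⌋) (not ⌊ v ≟ w ⌋) (not ⌊ w ≟ u ⌋))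

  isBad-intro : ∀ {u v w} → exactlyTwo (adj G u v) (adj G v w) (adj G w u) ≡ true →
                u ≢ v → v ≢ w → w ≢ u → isBad G u v w ≡ true
  isBad-intro {u} {v} {w} two u≢v v≢w w≢u
    rewrite isBad-exactlyTwo u v w | two
          | ⌊⌋-false (u ≟ v) u≢v | ⌊⌋-false (v ≟ w) v≢w | ⌊⌋-false (w ≟ u) w≢u = refl

  isBad⇒exactlyTwo : ∀ {u v w} → isBad G u v w ≡ true → exactlyTwo (adj G u v) (adj G v w) (adj G w u) ≡ true
  isBad⇒exactlyTwo {u} {v} {w} bad = ∧-conicalˡ _ (distinct3 u v w) (trans (sym (isBad-exactlyTwo u v w)) bad)

  isBad-diag : ∀ u v → isBad G u v v ≡ false
  isBad-diag u v rewrite isBad-exactlyTwo u v v | ⌊⌋-true (v ≟ v) refl | ∧-zeroʳ (not ⌊ u ≟ v ⌋) =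
    ∧-zeroʳ (exactlyTwo (adj G u v) (adj G v v) (adj G v u))

  module _ (R : VSet n) where

    isBadIn-intro : ∀ {u v w} → R u ≡ true → R v ≡ true → R w ≡ true → isBad G u v w ≡ true →
                    isBadIn G R u v w ≡ true
    isBadIn-intro Ru Rv Rw bad = ∧-true⁺ Ru (∧-true⁺ Rv (∧-true⁺ Rw bad))

    isBadIn⇒isBad : ∀ {u v w} → isBadIn G R u v w ≡ true → isBad G u v w ≡ true
    isBadIn⇒isBad {u} {v} {w} bad =
      ∧-conicalʳ (R w) _ (∧-conicalʳ (R v) _ (∧-conicalʳ (R u) _ bad))

    isBadIn-members : ∀ {u v w} → isBadIn G R u v w ≡ true → R v ≡ true × R w ≡ true
    isBadIn-members {u} {v} {w} bad = ∧-conicalˡ (R v) _ inner , ∧-conicalˡ (R w) _ (∧-conicalʳ (R v) _ inner)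
      where inner = ∧-conicalʳ (R u) _ bad

    isBadIn-rotate : ∀ u v w → isBadIn G R u v w ≡ isBadIn G R v w u
    isBadIn-rotate u v w = trans (cong (λ b → R u ∧ R v ∧ R w ∧ b) (isBad-rotate u v w))
      (solve 4 (λ a b c d → a ⊕ (b ⊕ (c ⊕ d)) ⊜ b ⊕ (c ⊕ (a ⊕ d))) refl (R u) (R v) (R w) (isBad G v w u))
      where open ∧-Solver

    isBadIn-swap : ∀ u v w → isBadIn G R u v w ≡ isBadIn G R u w v
    isBadIn-swap u v w = trans (cong (λ b → R u ∧ R v ∧ R w ∧ b) (isBad-swap u v w))
      (solve 4 (λ a b c d → a ⊕ (b ⊕ (c ⊕ d)) ⊜ a ⊕ (c ⊕ (b ⊕ d))) refl (R u) (R v) (R w) (isBad G u w v))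
      where open ∧-Solver

    isBadIn-diag : ∀ u v → isBadIn G R u v v ≡ false
    isBadIn-diag u v = ¬-not λ bad → contradiction (trans (sym (isBadIn⇒isBad bad)) (isBad-diag u v)) λ ()

-- One pivot step

costWithin : ∀ {n} → Graph n → VSet n → List (VSet n) → ℚ
costWithin G R C = ΣPairs (λ v w → b2ℚ (R v ∧ R w ∧ (adj G v w xor sameIn C v w)))

massWithin : ∀ {n} → LPVars n → VSet n → ℚ
massWithin x R = ΣPairs (λ v w → [ R v ∧ R w ]· x v w)

-- rv, rw: v, w ∈ R;  a, b: v, w lie in the pivot's closed neighbourhood;  e: vw ∈ E;
-- s: v, w share a later cluster.
misclassified-split : ∀ rv rw a b e s →
  (s ≡ true → (rv ∧ not (rv ∧ a)) ≡ true × (rw ∧ not (rw ∧ b)) ≡ true) →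
  (rv ∧ rw ∧ (e xor ((rv ∧ a) ∧ (rw ∧ b) ∨ s))) ≡ true →
  ((rv ∧ not (rv ∧ a)) ∧ (rw ∧ not (rw ∧ b)) ∧ (e xor s)) ≡ true ⊎
  rv ≡ true × rw ≡ true × exactlyTwo a e b ≡ true
misclassified-split true true false false e     s     _     wrong = inj₁ wrong
misclassified-split true true true  true  false s     _     _     = inj₂ (refl , refl , refl)
misclassified-split true true true  false true  false _     _     = inj₂ (refl , refl , refl)
misclassified-split true true false true  true  false _     _     = inj₂ (refl , refl , refl)
misclassified-split true true true  false _     true  later _     = contradiction (proj₁ (later refl)) λ ()
misclassified-split true true false true  _     true  later _     = contradiction (proj₂ (later refl)) λ ()
misclassified-split true true true  true  true  _     _     ()
misclassified-split true true true  false false false _     ()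
misclassified-split true true false true  false false _     ()
misclassified-split true false _ _ _ _ _ ()
misclassified-split false _ _ _ _ _ _ ()

module PivotStep {n : ℕ} (G : Graph n) (R : VSet n) (u : Fin n) (Ru : R u ≡ true) where

  K : VSet n
  K = clusterOf G R u

  R' : VSet n
  R' = removeSet R K

  R'⊆R : ∀ {v} → R' v ≡ true → R v ≡ true
  R'⊆R {v} = proj₁ ∘ ∧-true⁻ {R v}

  u∈K : K u ≡ true
  u∈K = ∧-true⁺ Ru (cong (_∨ adj G u u) (⌊⌋-true (u ≟ u) refl))

  K⇒∉R' : ∀ {v} → K v ≡ true → R' v ≡ false
  K⇒∉R' {v} Kv rewrite Kv = ∧-zeroʳ (R v)

  cluster-pattern⇒isBadIn : ∀ {v w} → v ≢ w → R v ≡ true → R w ≡ true →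
    exactlyTwo (⌊ v ≟ u ⌋ ∨ adj G u v) (adj G v w) (⌊ w ≟ u ⌋ ∨ adj G u w) ≡ true →
    isBadIn G R u v w ≡ true
  cluster-pattern⇒isBadIn {v} {w} v≢w Rv Rw two with v ≟ u | w ≟ u
  ... | yes refl | yes refl = contradiction refl v≢w
  ... | yes refl | no _ = contradiction (trans (sym two) (exactlyTwo-true-p-p (adj G u w))) λ ()
  ... | no _ | yes refl rewrite Graph.sym G v u =
    contradiction (trans (sym two) (exactlyTwo-p-p-true (adj G u v))) λ ()
  ... | no v≢u | no w≢u rewrite Graph.sym G u w =
    isBadIn-intro G R Ru Rv Rw (isBad-intro G two (v≢u ∘ sym) v≢w w≢u)

  cost-step : ∀ {C} → (∀ v w → sameIn C v w ≡ true → R' v ≡ true × R' w ≡ true) →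
              costWithin G R (K ∷ C) ≤ costWithin G R' C + badCount G R u
  cost-step {C} C⊆R' = ≤-trans (ΣPairs-mono λ v w v<w → b2ℚ-cover (charged (toℕ<⇒≢ v<w)))
    (≤-reflexive (ΣPairs-+ (λ v w → b2ℚ (R' v ∧ R' w ∧ (adj G v w xor sameIn C v w)))
                           (λ v w → b2ℚ (isBadIn G R u v w))))
    where
    charged : ∀ {v w} → v ≢ w → (R v ∧ R w ∧ (adj G v w xor sameIn (K ∷ C) v w)) ≡ true →
              (R' v ∧ R' w ∧ (adj G v w xor sameIn C v w)) ≡ true ⊎ isBadIn G R u v w ≡ true
    charged {v} {w} v≢w wrong
      with misclassified-split (R v) (R w) (⌊ v ≟ u ⌋ ∨ adj G u v) (⌊ w ≟ u ⌋ ∨ adj G u w)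
             (adj G v w) (sameIn C v w) (C⊆R' v w) wrong
    ... | inj₁ still-wrong     = inj₁ still-wrong
    ... | inj₂ (Rv , Rw , two) = inj₂ (cluster-pattern⇒isBadIn v≢w Rv Rw two)

  isBadIn-meets-cluster : ∀ {v w} → isBadIn G R u v w ≡ true → K v ≡ true ⊎ K w ≡ true
  isBadIn-meets-cluster {v} {w} bad with isBadIn-members G R bad
  ... | Rv , Rw with exactlyTwo-∨ _ (adj G v w) _ (isBad⇒exactlyTwo G (isBadIn⇒isBad G R bad))
  ... | inj₁ uv = inj₁ (∧-true⁺ Rv (trans (cong (⌊ v ≟ u ⌋ ∨_) uv) (∨-zeroʳ _)))
  ... | inj₂ wu = inj₂ (∧-true⁺ Rw (trans (cong (⌊ w ≟ u ⌋ ∨_) (trans (Graph.sym G u w) wu)) (∨-zeroʳ _)))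

  mass-step : ∀ (x : LPVars n) → (∀ v w → v ≢ w → 0ℚ ≤ x v w) →
              massWithin x R' + badMass G x R u ≤ massWithin x R
  mass-step x x≥0 = ≤-trans
    (≤-reflexive (sym (ΣPairs-+ (λ v w → [ R' v ∧ R' w ]· x v w) (λ v w → [ isBadIn G R u v w ]· x v w))))
    (ΣPairs-mono λ v w v<w →
      []·-disjoint (x≥0 v w (toℕ<⇒≢ v<w)) remaining⊆R (uncurry ∧-true⁺ ∘ isBadIn-members G R) disjoint)
    where
    remaining⊆R : ∀ {v w} → R' v ∧ R' w ≡ true → R v ∧ R w ≡ true
    remaining⊆R {v} both with ∧-true⁻ {R' v} both
    ... | R'v , R'w = ∧-true⁺ (R'⊆R R'v) (R'⊆R R'w)
    disjoint : ∀ {v w} → R' v ∧ R' w ≡ true → isBadIn G R u v w ≡ true → ⊥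
    disjoint {v} both bad with ∧-true⁻ {R' v} both | isBadIn-meets-cluster bad
    ... | R'v , _ | inj₁ Kv = contradiction (trans (sym R'v) (K⇒∉R' Kv)) λ ()
    ... | _ , R'w | inj₂ Kw = contradiction (trans (sym R'w) (K⇒∉R' Kw)) λ ()

-- Charging bad triplets to the LP

module Charging {n : ℕ} (G : Graph n) (x : LPVars n) (x-sym : SymmetricVars x) (x-feasible : Feasible G x)
                (R : VSet n) where

  badCount-nonneg : ∀ v → 0ℚ ≤ badCount G R v
  badCount-nonneg v = ΣPairs-nonneg λ a b _ → b2ℚ-nonneg (isBadIn G R v a b)

  badMass-nonneg : ∀ v → 0ℚ ≤ badMass G x R v
  badMass-nonneg v =
    ΣPairs-nonneg λ a b a<b → []·-nonneg (isBadIn G R v a b) (proj₁ x-feasible a b (toℕ<⇒≢ a<b))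

  badMass-outside : ∀ {v} → R v ≡ false → badMass G x R v ≡ 0ℚ
  badMass-outside {v} Rv = ΣPairs-zero λ a b → cong (λ r → [ r ∧ R a ∧ R b ∧ isBad G v a b ]· x a b) Rv

  count : Fin n → Fin n → Fin n → ℚ
  count v a b = b2ℚ (isBadIn G R v a b)

  mass : Fin n → Fin n → Fin n → ℚ
  mass v a b = [ isBadIn G R v a b ]· x a b

  -- By feasibility, the three pairs of a bad triplet carry LP mass at least 1.
  charge : ∀ v a b → count v a b ≤ mass v a b + mass a b v + mass b v a
  charge v a b rewrite sym (isBadIn-rotate G R v a b) | isBadIn-rotate G R b v a with isBadIn G R v a b in bad
  ... | true  = ≤-trans (proj₂ x-feasible v a b (isBadIn⇒isBad G R bad))
                        (≤-reflexive (trans (+-assoc (x v a) (x a b) (x b v)) (+-comm (x v a) _)))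
  ... | false = ≤-refl

  count-doubled : ∑³ count ≡ sum (badCount G R) + sum (badCount G R)
  count-doubled = trans
    (sum-cong-≗ λ v → ∑²-symmetric (count v) (λ a b → cong b2ℚ (isBadIn-swap G R v a b))
                                             (λ a → cong b2ℚ (isBadIn-diag G R v a)))
    (∑-distrib-+ (badCount G R) (badCount G R))

  mass-doubled : ∑³ mass ≡ sum (badMass G x R) + sum (badMass G x R)
  mass-doubled = trans
    (sum-cong-≗ λ v → ∑²-symmetric (mass v) (λ a b → cong₂ [_]·_ (isBadIn-swap G R v a b) (x-sym a b))
                                            (λ a → cong ([_]· x a a) (isBadIn-diag G R v a)))
    (∑-distrib-+ (badMass G x R) (badMass G x R))

  ∑badCount≤three*∑badMass : sum (badCount G R) ≤ three * sum (badMass G x R)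
  ∑badCount≤three*∑badMass = halve-≤ (begin
    C + C                                         ≡⟨ count-doubled ⟨
    ∑³ count                                      ≤⟨ ∑³-mono charge ⟩
    ∑³ (λ v a b → mass v a b + rotated v a b + rotated² v a b)
      ≡⟨ trans (∑³-+ _ rotated²) (cong (_+ ∑³ rotated²) (∑³-+ mass rotated)) ⟩
    ∑³ mass + ∑³ rotated + ∑³ rotated²
      ≡⟨ cong₂ (λ s t → ∑³ mass + s + t) (∑³-rotate mass) (trans (∑³-rotate rotated) (∑³-rotate mass)) ⟩
    ∑³ mass + ∑³ mass + ∑³ mass                   ≡⟨ cong (λ t → t + t + t) mass-doubled ⟩
    (M + M) + (M + M) + (M + M)                   ≡⟨ six-copies M ⟩
    three * M + three * M                         ∎)
    where
    open ≤-Reasoning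
    C = sum (badCount G R)
    M = sum (badMass G x R)
    rotated rotated² : Fin n → Fin n → Fin n → ℚ
    rotated  v a b = mass a b v
    rotated² v a b = mass b v a
    six-copies : ∀ q → (q + q) + (q + q) + (q + q) ≡ three * q + three * q
    six-copies = solve 1 (λ q → (q :+ q) :+ (q :+ q) :+ (q :+ q) := con three :* q :+ con three :* q) refl
      where open +-*-Solver

  open Ratio (badCount G R) (badMass G x R) badCount-nonneg badMass-nonneg

  pivot-exists : ∃ (λ v → R v ≡ true) → ∃ (ValidPivot G x R)
  pivot-exists = ratio-minimiser (λ v → R v Bool.≟ true)

  pivot-charge : ∀ {u} → ValidPivot G x R u → badCount G R u ≤ three * badMass G x R u
  pivot-charge {u} (_ , u-least) = ratio-bound 0≤three ∑badCount≤three*∑badMass u≼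
    where
    u≼ : ∀ v → u ≼ v
    u≼ v with R v Bool.≟ true
    ... | yes Rv = u-least v Rv
    ... | no  Rv≢true = ≼-massless (badMass-outside (¬-not Rv≢true))

-- Runs of Cluster

size : ∀ {n} → VSet n → ℕ
size {ℕ.zero}  _ = 0
size {ℕ.suc n} S = b2ℕ (S zero) ℕ.+ size (S ∘ suc)

b2ℕ-∧-≤ : ∀ r k → b2ℕ (r ∧ k) ℕ.≤ b2ℕ r
b2ℕ-∧-≤ false _     = ℕ.z≤n
b2ℕ-∧-≤ true  false = ℕ.z≤n
b2ℕ-∧-≤ true  true  = ℕ.≤-refl

b2ℕ-removed : ∀ {r k} → r ≡ true → k ≡ true → b2ℕ (r ∧ not k) ℕ.< b2ℕ r
b2ℕ-removed refl refl = ℕ.s≤s ℕ.z≤n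

size-removeSet-≤ : ∀ {n} (R K : VSet n) → size (removeSet R K) ℕ.≤ size R
size-removeSet-≤ {ℕ.zero}  R K = ℕ.z≤n
size-removeSet-≤ {ℕ.suc n} R K =
  ℕ.+-mono-≤ (b2ℕ-∧-≤ (R zero) (not (K zero))) (size-removeSet-≤ (R ∘ suc) (K ∘ suc))

size-removeSet-< : ∀ {n} (R K : VSet n) {u} → R u ≡ true → K u ≡ true → size (removeSet R K) ℕ.< size R
size-removeSet-< R K {zero}  Ru Ku = ℕ.+-mono-<-≤ (b2ℕ-removed Ru Ku) (size-removeSet-≤ (R ∘ suc) (K ∘ suc))
size-removeSet-< R K {suc u} Ru Ku =
  ℕ.+-mono-≤-< (b2ℕ-∧-≤ (R zero) (not (K zero))) (size-removeSet-< (R ∘ suc) (K ∘ suc) Ru Ku)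

module _ {n : ℕ} (G : Graph n) (x : LPVars n) (x-sym : SymmetricVars x) (x-feasible : Feasible G x) where

  Run-clusters-⊆ : ∀ {R C} → Run G x R C → ∀ v w → sameIn C v w ≡ true → R v ≡ true × R w ≡ true
  Run-clusters-⊆ (done _) v w ()
  Run-clusters-⊆ {R} (step u pivot run) v w same with ∨-true⁻ {clusterOf G R u v ∧ clusterOf G R u w} same
  ... | inj₁ together with ∧-true⁻ {clusterOf G R u v} together
  ...   | Kv , Kw = proj₁ (∧-true⁻ {R v} Kv) , proj₁ (∧-true⁻ {R w} Kw)
  Run-clusters-⊆ {R} (step u pivot run) v w same | inj₂ later = map R'⊆R R'⊆R (Run-clusters-⊆ run v w later)
    where open PivotStep G R u (proj₁ pivot)

  massWithin-nonneg : ∀ R → 0ℚ ≤ massWithin x R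
  massWithin-nonneg R = ΣPairs-nonneg λ v w v<w → []·-nonneg (R v ∧ R w) (proj₁ x-feasible v w (toℕ<⇒≢ v<w))

  cost-invariant : ∀ {R C} → Run G x R C → costWithin G R C ≤ three * massWithin x R
  cost-invariant {R} (done R-empty) = begin
    costWithin G R []  ≡⟨ ΣPairs-zero (λ v w → cong (λ r → b2ℚ (r ∧ R w ∧ (adj G v w xor false))) (R-empty v)) ⟩
    0ℚ                 ≤⟨ *-nonneg 0≤three (massWithin-nonneg R) ⟩
    three * massWithin x R ∎
    where open ≤-Reasoning
  cost-invariant {R} (step {C = C} u pivot run) = begin
    costWithin G R (K ∷ C)                              ≤⟨ cost-step {C} (Run-clusters-⊆ run) ⟩
    costWithin G R' C + badCount G R u                  ≤⟨ +-mono-≤ (cost-invariant run) (pivot-charge pivot) ⟩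
    three * massWithin x R' + three * badMass G x R u   ≡⟨ *-distribˡ-+ three (massWithin x R') _ ⟨
    three * (massWithin x R' + badMass G x R u)         ≤⟨ *-monoˡ-≤-nonNeg three {{nonNegative 0≤three}}
                                                             (mass-step x (proj₁ x-feasible)) ⟩
    three * massWithin x R                              ∎
    where
    open ≤-Reasoning
    open PivotStep G R u (proj₁ pivot)
    open Charging G x x-sym x-feasible R

  run-from : ∀ R → Acc ℕ._<_ (size R) → ∃ (Run G x R)
  run-from R (acc smaller) with any? (λ v → R v Bool.≟ true)
  ... | no  empty = [] , done (λ v → ¬-not (λ Rv → empty (v , Rv)))
  ... | yes nonempty with Charging.pivot-exists G x x-sym x-feasible R nonempty
  ...   | u , pivot@(Ru , _) =
    let C , run = run-from R' (smaller (size-removeSet-< R K Ru u∈K)) in K ∷ C , step u pivot run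
    where open PivotStep G R u Ru

-- Partitions as LP solutions

exactlyTwo-differs : ∀ e₁ e₂ e₃ s₁ s₂ s₃ → exactlyTwo e₁ e₂ e₃ ≡ true → exactlyTwo s₁ s₂ s₃ ≡ false →
                     e₁ xor s₁ ≡ true ⊎ e₂ xor s₂ ≡ true ⊎ e₃ xor s₃ ≡ true
exactlyTwo-differs e₁ e₂ e₃ s₁ s₂ s₃ e-two s-not-two
  with e₁ xor s₁ in d₁ | e₂ xor s₂ in d₂ | e₃ xor s₃ in d₃
... | true  | _     | _    = inj₁ refl
... | false | true  | _    = inj₂ (inj₁ refl)
... | false | false | true = inj₂ (inj₂ refl)
... | false | false | false
  with refl ← xor-false⇒≡ e₁ s₁ d₁ | refl ← xor-false⇒≡ e₂ s₂ d₂ | refl ← xor-false⇒≡ e₃ s₃ d₃ =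
  contradiction (trans (sym e-two) s-not-two) λ ()

same-label-triangle : ∀ {n m} (p : Fin n → Fin m) u v w →
                      exactlyTwo ⌊ p u ≟ p v ⌋ ⌊ p v ≟ p w ⌋ ⌊ p w ≟ p u ⌋ ≡ false
same-label-triangle p u v w with p u ≟ p v | p v ≟ p w | p w ≟ p u
... | yes uv | yes vw | no  wu = contradiction (sym (trans uv vw)) wu
... | yes uv | no  vw | yes wu = contradiction (sym (trans wu uv)) vw
... | no  uv | yes vw | yes wu = contradiction (sym (trans vw wu)) uv
... | yes _  | yes _  | yes _  = refl
... | yes _  | no  _  | no  _  = refl
... | no  _  | yes _  | no  _  = refl
... | no  _  | no  _  | yes _  = refl
... | no  _  | no  _  | no  _  = refl

module _ {n : ℕ} (G : Graph n) (p : Fin n → Fin n) where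

  mismatch : Fin n → Fin n → Bool
  mismatch u v = adj G u v xor ⌊ p u ≟ p v ⌋

  labelVars : LPVars n
  labelVars u v = b2ℚ (mismatch u v)

  labelVars-sym : SymmetricVars labelVars
  labelVars-sym u v = cong₂ (λ e s → b2ℚ (e xor s)) (Graph.sym G u v) (⌊≟⌋-sym (p u) (p v))

  labelVars-feasible : Feasible G labelVars
  labelVars-feasible = (λ u v _ → b2ℚ-nonneg (mismatch u v)) , covered
    where
    covered : ∀ u v w → isBad G u v w ≡ true → 1ℚ ≤ labelVars u v + labelVars v w + labelVars w u
    covered u v w bad = 1≤b2ℚ-sum {mismatch u v} {mismatch v w} {mismatch w u}
      (exactlyTwo-differs (adj G u v) (adj G v w) (adj G w u) ⌊ p u ≟ p v ⌋ ⌊ p v ≟ p w ⌋ ⌊ p w ≟ p u ⌋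
        (isBad⇒exactlyTwo G bad) (same-label-triangle p u v w))

lemma15 : ∀ (n : ℕ) (G : Graph n) (x : LPVars n) →
    SymmetricVars x → Feasible G x →
    (∃ λ (C : List (VSet n)) → Run G x fullSet C) ×
    (∀ (C : List (VSet n)) → Run G x fullSet C → cost G C ≤ three * objective x) ×
    (∀ (α : ℚ) → 1ℚ ≤ α → ApproxLP G α x →
      ∀ (C : List (VSet n)) → Run G x fullSet C →
      ∀ (p : Fin n → Fin n) → cost G C ≤ (three * α) * costLabel G p)
lemma15 n G x x-sym x-feasible =
  run-from G x x-sym x-feasible fullSet (<-wellFounded _) , cost-bound , approximation
  where
  cost-bound : ∀ C → Run G x fullSet C → cost G C ≤ three * objective x
  cost-bound C = cost-invariant G x x-sym x-feasible

  approximation : ∀ α → 1ℚ ≤ α → ApproxLP G α x → ∀ C → Run G x fullSet C →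
                  ∀ p → cost G C ≤ (three * α) * costLabel G p
  -- The bound does not need 1 ≤ α.
  approximation α _ (_ , optimal) C run p = begin
    cost G C                     ≤⟨ cost-bound C run ⟩
    three * objective x          ≤⟨ *-monoˡ-≤-nonNeg three {{nonNegative 0≤three}}
                                      (optimal (labelVars G p) (labelVars-sym G p) (labelVars-feasible G p)) ⟩
    three * (α * costLabel G p)  ≡⟨ *-assoc three α (costLabel G p) ⟨
    three * α * costLabel G p    ∎
    where open ≤-Reasoning
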